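{- For every integer $n\ge 1$, $\mathrm{a}_{000,011}(n)=n$.
   Context: An ascent of an integer word $x_1\cdots x_n$ is an index $j$ with $x_j<x_{j+1}$; $\mathrm{asc}(x_1\cdots x_n)$ denotes the number of ascents. An ascent sequence of length $n$ is a sequence $x_1\cdots x_n$ of nonnegative integers with $x_1=0$ and $x_i\le \mathrm{asc}(x_1\cdots x_{i-1})+1$ for all $1<i\le n$. A pattern is a word $p=p_1\cdots p_k$ of nonnegative integers whose set of values is $\{0,1,\dots,m\}$ for some $m$. A word $x_1\cdots x_n$ contains $p$ if there are indices $i_1<\cdots<i_k$ such that $x_{i_1}\cdots x_{i_k}$ is order-isomorphic to $p$ (i.e. for all $s,t$, $x_{i_s}<x_{i_t}$ iff $p_s<p_t$ and $x_{i_s}=x_{i_t}$ iff $p_s=p_t$); otherwise it avoids $p$. For a list $B$ of patterns, $\mathcal{A}_B(n)$ is the set of ascent sequences of length $n$ avoiding every pattern in $B$, and $\mathrm{a}_B(n)=|\mathcal{A}_B(n)|$. -}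

module Defs where

open import Data.Bool using (Bool; true; false; _∧_; _∨_; not; if_then_else_; T)
open import Data.Nat using (ℕ; zero; suc; _≡ᵇ_; _<ᵇ_; _≤ᵇ_; _+_)
open import Data.List using (List; []; _∷_; map; _++_; length; zipWith)
open import Data.Bool.ListAction using (all; any)
open import Data.Product using (Σ; _×_)
open import Relation.Binary.PropositionalEquality using (_≡_)

asc : List ℕ → ℕ
asc [] = 0
asc (x ∷ []) = 0
asc (x ∷ y ∷ ys) = (if x <ᵇ y then 1 else 0) + asc (y ∷ ys)

ascOK : List ℕ → List ℕ → Bool
ascOK pre [] = true
ascOK pre (y ∷ ys) = (y ≤ᵇ suc (asc pre)) ∧ ascOK (pre ++ (y ∷ [])) ys

isAscentSeq : List ℕ → Bool
isAscentSeq [] = true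
isAscentSeq (x ∷ xs) = (x ≡ᵇ 0) ∧ ascOK (x ∷ []) xs

subseqs : List ℕ → List (List ℕ)
subseqs [] = [] ∷ []
subseqs (x ∷ xs) = map (x ∷_) (subseqs xs) ++ subseqs xs

_⇔ᵇ_ : Bool → Bool → Bool
true ⇔ᵇ b = b
false ⇔ᵇ b = not b

sameOrder : ℕ → ℕ → ℕ → ℕ → Bool
sameOrder a c b d = ((a <ᵇ c) ⇔ᵇ (b <ᵇ d)) ∧ (((c <ᵇ a) ⇔ᵇ (d <ᵇ b)) ∧ ((a ≡ᵇ c) ⇔ᵇ (b ≡ᵇ d)))

orderIso : List ℕ → List ℕ → Bool
orderIso [] [] = true
orderIso [] (_ ∷ _) = false
orderIso (_ ∷ _) [] = false
orderIso (a ∷ u) (b ∷ p) =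
  all (λ q → q) (zipWith (λ c d → sameOrder a c b d) u p) ∧ orderIso u p

contains : List ℕ → List ℕ → Bool
contains p w = any (λ s → orderIso s p) (subseqs w)

avoids : List ℕ → List ℕ → Bool
avoids p w = not (contains p w)

avoidsAll : List (List ℕ) → List ℕ → Bool
avoidsAll B w = all (λ p → avoids p w) B

-- The set 𝒜_B(n): ascent sequences of length n avoiding every pattern of B.
-- Predicates are T of booleans, so proofs are unique and this Σ-type has
-- exactly a_B(n) elements.
𝒜 : List (List ℕ) → ℕ → Set
𝒜 B n = Σ (List ℕ) (λ w → (length w ≡ n) × T (isAscentSeq w ∧ avoidsAll B w))

-- After the initial 0, a 011-avoiding word cannot repeat a positive letter, and a
-- 000-avoiding one cannot repeat 0; conversely a word whose tail has no repeated
-- letter avoids every pattern x y y. So the words counted are the ascent sequences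
-- 0 t with t repetition-free. Along such a t, the ascent bound x_i ≤ asc + 1 and
-- the freshness of each letter force every positive letter to be one more than
-- the number of ascents so far, which is also the largest letter so far. Hence
-- t = 1 2 ⋯ n−1, or t is that run with one 0 inserted at one of n − 1 places.
module Submission where

open import Defs
open import Data.Nat using (ℕ; _≥_)
open import Data.List using (List; []; _∷_)
open import Data.Fin using (Fin)
open import Function.Bundles using (_⤖_)

open import Data.Bool using (Bool; true; false; not; _∧_; if_then_else_; T)
open import Data.Bool.Properties using (T-∧; T-≡; T-irrelevant)
open import Data.Nat using (zero; suc; _+_; _≤_; _<_; z≤n; s≤s; _<ᵇ_; _≤ᵇ_)
open import Data.Nat.Properties
  using (<⇒<ᵇ; ≤ᵇ⇒≤; ≡-irrelevant;
         +-identityʳ; +-comm; +-assoc; ≤-refl; ≤-antisym; <⇒≤; <⇒≢; ≤∧≢⇒<; n≮0; n<1+n; m<n⇒n≢0)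
open import Data.List using (length; map; _++_; zipWith)
open import Data.Bool.ListAction using (all)
open import Data.List.Properties using (∷-injectiveʳ; ++-assoc)
open import Data.List.Membership.Propositional using (_∈_; _∉_; find; lose)
open import Data.List.Membership.Propositional.Properties
  using (∈-map⁺; ∈-map⁻; ∈-++⁺ˡ; ∈-++⁺ʳ; ∈-++⁻)
open import Data.List.Relation.Unary.All as All using (All; []; _∷_)
open import Data.List.Relation.Unary.Any using (here; there)
open import Data.List.Relation.Unary.Any.Properties using (any⁺; any⁻)
open import Data.List.Relation.Unary.Unique.Propositional using (Unique; []; _∷_)
open import Data.List.Relation.Binary.Sublist.Propositional using (_⊆_; []; _∷_; _∷ʳ_; from∈; to∈)
open import Data.List.Relation.Binary.Sublist.Propositional.Properties using (∷⁻)
open import Data.Fin using (zero; suc)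
open import Data.Product using (Σ; ∃-syntax; _×_; _,_; proj₁; proj₂)
open import Data.Sum as Sum using (_⊎_; inj₁; inj₂)
open import Data.Unit using (tt)
open import Data.Empty using (⊥-elim)
open import Function.Bundles using (mk⤖; mk⇔; _⇔_; Equivalence)
open import Function.Definitions using (Injective)
open import Function.Consequences.Propositional using (strictlySurjective⇒surjective)
open import Relation.Nullary using (¬_)
open import Relation.Unary using (Irrelevant)
open import Relation.Binary.PropositionalEquality
  using (_≡_; _≢_; refl; sym; trans; cong; cong₂; subst; ≢-sym; module ≡-Reasoning)

open Equivalence using (to; from)

T-not : ∀ {b} → T (not b) ⇔ (¬ T b)
T-not {true}  = mk⇔ (λ ()) (λ ¬t → ¬t tt)
T-not {false} = mk⇔ (λ _ ()) (λ _ → tt)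

∈-subseqs⁺ : ∀ {s w} → s ⊆ w → s ∈ subseqs w
∈-subseqs⁺ []           = here refl
∈-subseqs⁺ (y ∷ʳ s⊆w)   = ∈-++⁺ʳ _ (∈-subseqs⁺ s⊆w)
∈-subseqs⁺ (refl ∷ s⊆w) = ∈-++⁺ˡ (∈-map⁺ _ (∈-subseqs⁺ s⊆w))

∈-subseqs⁻ : ∀ {s} w → s ∈ subseqs w → s ⊆ w
∈-subseqs⁻ []      (here refl) = []
∈-subseqs⁻ (x ∷ w) s∈ with ∈-++⁻ (map (x ∷_) (subseqs w)) s∈
... | inj₂ s∈′ = x ∷ʳ ∈-subseqs⁻ w s∈′
... | inj₁ s∈map with t , t∈ , refl ← ∈-map⁻ _ s∈map = refl ∷ ∈-subseqs⁻ w t∈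

contains⁺ : ∀ {p s w} → s ⊆ w → T (orderIso s p) → T (contains p w)
contains⁺ s⊆w iso = any⁺ _ (lose (∈-subseqs⁺ s⊆w) iso)

contains⁻ : ∀ p w → T (contains p w) → ∃[ s ] s ⊆ w × T (orderIso s p)
contains⁻ p w c with s , s∈ , iso ← find (any⁻ _ (subseqs w) c) = s , ∈-subseqs⁻ w s∈ , iso

orderIso-∷⁻ : ∀ a s b p → T (orderIso (a ∷ s) (b ∷ p)) → T (orderIso s p)
orderIso-∷⁻ a s b p iso = proj₂ (to (T-∧ {all (λ q → q) (zipWith (λ c d → sameOrder a c b d) s p)}) iso)

orderIso-sameOrder : ∀ a c s b d p → T (orderIso (a ∷ c ∷ s) (b ∷ d ∷ p)) → T (sameOrder a c b d)
orderIso-sameOrder a c s b d p iso = proj₁ (to (T-∧ {sameOrder a c b d}) (proj₁ (to (T-∧ {heads}) iso)))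
  where
  heads : Bool
  heads = sameOrder a c b d ∧ all (λ q → q) (zipWith (λ c′ d′ → sameOrder a c′ b d′) s p)

orderIso⇒length≡ : ∀ s p → T (orderIso s p) → length s ≡ length p
orderIso⇒length≡ []      []      _   = refl
orderIso⇒length≡ (a ∷ s) (b ∷ p) iso = cong suc (orderIso⇒length≡ s p (orderIso-∷⁻ a s b p iso))

length≡3 : ∀ {a} {A : Set a} (s : List A) → length s ≡ 3 → ∃[ a ] ∃[ b ] ∃[ c ] s ≡ a ∷ b ∷ c ∷ []
length≡3 (a ∷ b ∷ c ∷ []) refl = a , b , c , refl

sameOrder-refl : ∀ a b → T (sameOrder a a b b)
sameOrder-refl (suc a) b       = sameOrder-refl a b
sameOrder-refl zero    (suc b) = sameOrder-refl zero b
sameOrder-refl zero    zero    = tt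

sameOrder-≡ : ∀ a c b → T (sameOrder a c b b) → a ≡ c
sameOrder-≡ zero    zero    _ _  = refl
sameOrder-≡ (suc a) (suc c) b so = cong suc (sameOrder-≡ a c b so)
-- Otherwise `so` demands both b < b and its negation.
sameOrder-≡ zero    (suc c) b so with b <ᵇ b
... | true  = ⊥-elim so
... | false = ⊥-elim so
sameOrder-≡ (suc a) zero    b so with b <ᵇ b
... | true  = ⊥-elim so
... | false = ⊥-elim so

orderIso-xyy : ∀ s x y → T (orderIso s (x ∷ y ∷ y ∷ [])) → ∃[ a ] ∃[ b ] s ≡ a ∷ b ∷ b ∷ []
orderIso-xyy s x y iso with a , b , c , refl ← length≡3 s (orderIso⇒length≡ s _ iso) =
  a , b , cong (λ z → a ∷ b ∷ z ∷ []) (sym (sameOrder-≡ b c y bc))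
  where
  bc : T (sameOrder b c y y)
  bc = orderIso-sameOrder b c [] y y [] (orderIso-∷⁻ a (b ∷ c ∷ []) x (y ∷ y ∷ []) iso)

orderIso-0bb : ∀ v → T (orderIso (0 ∷ suc v ∷ suc v ∷ []) (0 ∷ 1 ∷ 1 ∷ []))
orderIso-0bb v = from (T-∧ {sameOrder v v 0 0 ∧ true}) (from (T-∧ {sameOrder v v 0 0}) (sameOrder-refl v 0 , tt) , tt)

module _ {a} {A : Set a} where

  Unique⇒¬[x,x]⊆ : ∀ {xs : List A} {x} → Unique xs → ¬ (x ∷ x ∷ []) ⊆ xs
  Unique⇒¬[x,x]⊆ (_ ∷ u)    (_ ∷ʳ xx⊆) = Unique⇒¬[x,x]⊆ u xx⊆
  Unique⇒¬[x,x]⊆ (x∉ ∷ _)  (refl ∷ x⊆) = All.lookup x∉ (to∈ x⊆) refl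

  ¬[x,x]⊆⇒Unique : ∀ {xs : List A} → (∀ x → ¬ (x ∷ x ∷ []) ⊆ xs) → Unique xs
  ¬[x,x]⊆⇒Unique {[]}     _     = []
  ¬[x,x]⊆⇒Unique {y ∷ ys} noRep =
    All.tabulate (λ { y∈ys refl → noRep y (refl ∷ from∈ y∈ys) })
    ∷ ¬[x,x]⊆⇒Unique (λ x xx⊆ → noRep x (y ∷ʳ xx⊆))

pattern [000,011] = (0 ∷ 0 ∷ 0 ∷ []) ∷ (0 ∷ 1 ∷ 1 ∷ []) ∷ []

Unique⇒avoids-xyy : ∀ {u t} x y → Unique t → T (avoids (x ∷ y ∷ y ∷ []) (u ∷ t))
Unique⇒avoids-xyy {u} {t} x y uniq = from T-not λ c →
  let s , s⊆ , iso = contains⁻ _ (u ∷ t) c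
      _ , _ , s≡   = orderIso-xyy s x y iso
  in Unique⇒¬[x,x]⊆ uniq (∷⁻ (subst (_⊆ u ∷ t) s≡ s⊆))

avoids[000,011]⇔Unique : ∀ t → T (avoidsAll [000,011] (0 ∷ t)) ⇔ Unique t
avoids[000,011]⇔Unique t = mk⇔ avoiding⇒unique unique⇒avoiding
  where
  avoiding⇒unique : T (avoidsAll [000,011] (0 ∷ t)) → Unique t
  avoiding⇒unique av = ¬[x,x]⊆⇒Unique λ
    { zero    xx⊆ → to T-not avoids-000 (contains⁺ (refl ∷ xx⊆) tt)
    ; (suc v) xx⊆ → to T-not avoids-011 (contains⁺ (refl ∷ xx⊆) (orderIso-0bb v)) }
    where
    avoids-000 : T (avoids (0 ∷ 0 ∷ 0 ∷ []) (0 ∷ t))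
    avoids-000 = proj₁ (to (T-∧ {avoids (0 ∷ 0 ∷ 0 ∷ []) (0 ∷ t)}) av)
    avoids-011 : T (avoids (0 ∷ 1 ∷ 1 ∷ []) (0 ∷ t))
    avoids-011 = proj₁ (to (T-∧ {avoids (0 ∷ 1 ∷ 1 ∷ []) (0 ∷ t)}) (proj₂ (to (T-∧ {avoids (0 ∷ 0 ∷ 0 ∷ []) (0 ∷ t)}) av)))
  unique⇒avoiding : Unique t → T (avoidsAll [000,011] (0 ∷ t))
  unique⇒avoiding uniq =
    from (T-∧ {avoids (0 ∷ 0 ∷ 0 ∷ []) (0 ∷ t)}) (Unique⇒avoids-xyy 0 0 uniq ,
      from (T-∧ {avoids (0 ∷ 1 ∷ 1 ∷ []) (0 ∷ t)}) (Unique⇒avoids-xyy 0 1 uniq , tt))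

ascBit : ℕ → ℕ → ℕ
ascBit x y = if x <ᵇ y then 1 else 0

-- ascOK for a prefix with `a` ascents whose last letter is `l`.
ascOKFrom : ℕ → ℕ → List ℕ → Bool
ascOKFrom a l []       = true
ascOKFrom a l (y ∷ ys) = (y ≤ᵇ suc a) ∧ ascOKFrom (a + ascBit l y) y ys

asc-snoc : ∀ q x y → asc (q ++ x ∷ y ∷ []) ≡ asc (q ++ x ∷ []) + ascBit x y
asc-snoc []          x y = +-identityʳ (ascBit x y)
asc-snoc (w ∷ [])    x y = cong₂ _+_ (sym (+-identityʳ (ascBit w x))) (+-identityʳ (ascBit x y))
asc-snoc (w ∷ v ∷ q) x y = trans (cong (ascBit w v +_) (asc-snoc (v ∷ q) x y)) (sym (+-assoc (ascBit w v) _ _))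

ascOK≡ascOKFrom : ∀ q l ys → ascOK (q ++ l ∷ []) ys ≡ ascOKFrom (asc (q ++ l ∷ [])) l ys
ascOK≡ascOKFrom q l []       = refl
ascOK≡ascOKFrom q l (y ∷ ys) = cong ((y ≤ᵇ suc (asc (q ++ l ∷ []))) ∧_) (begin
  ascOK ((q ++ l ∷ []) ++ y ∷ []) ys              ≡⟨ ascOK≡ascOKFrom (q ++ l ∷ []) y ys ⟩
  ascOKFrom (asc ((q ++ l ∷ []) ++ y ∷ [])) y ys  ≡⟨ cong (λ a → ascOKFrom a y ys) asc-step ⟩
  ascOKFrom (asc (q ++ l ∷ []) + ascBit l y) y ys ∎)
  where
  open ≡-Reasoning
  asc-step : asc ((q ++ l ∷ []) ++ y ∷ []) ≡ asc (q ++ l ∷ []) + ascBit l y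
  asc-step = trans (cong asc (++-assoc q (l ∷ []) (y ∷ []))) (asc-snoc q l y)

+-ascBit-suc : ∀ {l c} → l ≤ c → c + ascBit l (suc c) ≡ suc c
+-ascBit-suc {l} {c} l≤c rewrite to T-≡ (<⇒<ᵇ (s≤s l≤c)) = +-comm c 1

ascOKFrom-head : ∀ {a l} y ys → T (ascOKFrom a l (y ∷ ys)) → y ≤ suc a
ascOKFrom-head {a} y ys ok = ≤ᵇ⇒≤ y (suc a) (proj₁ (to (T-∧ {y ≤ᵇ suc a}) ok))

ascOKFrom-0∷ : ∀ c l ys → ascOKFrom c l (0 ∷ ys) ≡ ascOKFrom c 0 ys
ascOKFrom-0∷ c l ys = cong (λ a → ascOKFrom a 0 ys) (+-identityʳ c)

ascOKFrom-suc∷ : ∀ {c l} ys → l ≤ c → ascOKFrom c l (suc c ∷ ys) ≡ ascOKFrom (suc c) (suc c) ys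
ascOKFrom-suc∷ {c} ys l≤c =
  cong₂ _∧_ (to T-≡ (<⇒<ᵇ (n<1+n c))) (cong (λ a → ascOKFrom a (suc c) ys) (+-ascBit-suc l≤c))

ascendingFrom : ℕ → ℕ → List ℕ
ascendingFrom c zero    = []
ascendingFrom c (suc L) = suc c ∷ ascendingFrom (suc c) L

-- Index zero: no second 0. Index suc j: a 0 inserted after the first j letters.
canonicalTail : (c L : ℕ) → Fin (suc L) → List ℕ
canonicalTail c L       zero          = ascendingFrom c L
canonicalTail c (suc L) (suc zero)    = 0 ∷ ascendingFrom c L
canonicalTail c (suc L) (suc (suc j)) = suc c ∷ canonicalTail (suc c) L (suc j)

canonical : (m : ℕ) → Fin (suc m) → List ℕ
canonical m k = 0 ∷ canonicalTail 0 m k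

ZeroOrAbove : ℕ → ℕ → Set
ZeroOrAbove c y = y ≡ 0 ⊎ c < y

length-ascendingFrom : ∀ c L → length (ascendingFrom c L) ≡ L
length-ascendingFrom c zero    = refl
length-ascendingFrom c (suc L) = cong suc (length-ascendingFrom (suc c) L)

length-canonicalTail : ∀ c L k → length (canonicalTail c L k) ≡ L
length-canonicalTail c L       zero          = length-ascendingFrom c L
length-canonicalTail c (suc L) (suc zero)    = cong suc (length-ascendingFrom c L)
length-canonicalTail c (suc L) (suc (suc j)) = cong suc (length-canonicalTail (suc c) L (suc j))

ascendingFrom-above : ∀ c L → All (c <_) (ascendingFrom c L)
ascendingFrom-above c zero    = []
ascendingFrom-above c (suc L) = n<1+n c ∷ All.map <⇒≤ (ascendingFrom-above (suc c) L)

canonicalTail-zeroOrAbove : ∀ c L k → All (ZeroOrAbove c) (canonicalTail c L k)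
canonicalTail-zeroOrAbove c L       zero          = All.map inj₂ (ascendingFrom-above c L)
canonicalTail-zeroOrAbove c (suc L) (suc zero)    = inj₁ refl ∷ All.map inj₂ (ascendingFrom-above c L)
canonicalTail-zeroOrAbove c (suc L) (suc (suc j)) =
  inj₂ (n<1+n c) ∷ All.map (Sum.map₂ <⇒≤) (canonicalTail-zeroOrAbove (suc c) L (suc j))

0∉ascendingFrom : ∀ c L → 0 ∉ ascendingFrom c L
0∉ascendingFrom c L 0∈ = n≮0 (All.lookup (ascendingFrom-above c L) 0∈)

0∈canonicalTail : ∀ c L j → 0 ∈ canonicalTail c L (suc j)
0∈canonicalTail c (suc L) zero    = here refl
0∈canonicalTail c (suc L) (suc j) = there (0∈canonicalTail (suc c) L j)

unique-ascendingFrom : ∀ c L → Unique (ascendingFrom c L)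
unique-ascendingFrom c zero    = []
unique-ascendingFrom c (suc L) = All.map <⇒≢ (ascendingFrom-above (suc c) L) ∷ unique-ascendingFrom (suc c) L

unique-canonicalTail : ∀ c L k → Unique (canonicalTail c L k)
unique-canonicalTail c L       zero          = unique-ascendingFrom c L
unique-canonicalTail c (suc L) (suc zero)    =
  All.map (λ c<y → ≢-sym (m<n⇒n≢0 c<y)) (ascendingFrom-above c L) ∷ unique-ascendingFrom c L
unique-canonicalTail c (suc L) (suc (suc j)) =
  All.map suc≢ (canonicalTail-zeroOrAbove (suc c) L (suc j)) ∷ unique-canonicalTail (suc c) L (suc j)
  where
  suc≢ : ∀ {y} → ZeroOrAbove (suc c) y → suc c ≢ y
  suc≢ (inj₁ refl) ()
  suc≢ (inj₂ c<y)  = <⇒≢ c<y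

canonicalTail-injective : ∀ c L → Injective _≡_ _≡_ (canonicalTail c L)
canonicalTail-injective c L       {zero}        {zero}         _ = refl
canonicalTail-injective c L       {zero}        {suc j}        e =
  ⊥-elim (0∉ascendingFrom c L (subst (0 ∈_) (sym e) (0∈canonicalTail c L j)))
canonicalTail-injective c L       {suc j}       {zero}         e =
  ⊥-elim (0∉ascendingFrom c L (subst (0 ∈_) e (0∈canonicalTail c L j)))
canonicalTail-injective c (suc L) {suc zero}    {suc zero}     _ = refl
canonicalTail-injective c (suc L) {suc (suc j)} {suc (suc j′)} e =
  cong suc (canonicalTail-injective (suc c) L (∷-injectiveʳ e))

ascOKFrom-ascendingFrom : ∀ c l L → l ≤ c → T (ascOKFrom c l (ascendingFrom c L))
ascOKFrom-ascendingFrom c l zero    _   = tt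
ascOKFrom-ascendingFrom c l (suc L) l≤c =
  subst T (sym (ascOKFrom-suc∷ (ascendingFrom (suc c) L) l≤c)) (ascOKFrom-ascendingFrom (suc c) (suc c) L ≤-refl)

ascOKFrom-canonicalTail : ∀ c l L k → l ≤ c → T (ascOKFrom c l (canonicalTail c L k))
ascOKFrom-canonicalTail c l L       zero          l≤c = ascOKFrom-ascendingFrom c l L l≤c
ascOKFrom-canonicalTail c l (suc L) (suc zero)    _   =
  subst T (sym (ascOKFrom-0∷ c l (ascendingFrom c L))) (ascOKFrom-ascendingFrom c 0 L z≤n)
ascOKFrom-canonicalTail c l (suc L) (suc (suc j)) l≤c =
  subst T (sym (ascOKFrom-suc∷ (canonicalTail (suc c) L (suc j)) l≤c))
    (ascOKFrom-canonicalTail (suc c) (suc c) L (suc j) ≤-refl)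

ZeroOrAbove-suc : ∀ {c z} → ZeroOrAbove c z × suc c ≢ z → ZeroOrAbove (suc c) z
ZeroOrAbove-suc (inj₁ z≡0 , _)   = inj₁ z≡0
ZeroOrAbove-suc (inj₂ c<z , c≢z) = inj₂ (≤∧≢⇒< c<z c≢z)

-- The invariant `All (ZeroOrAbove c)` records that the letters 1, …, c are used up.
classify-tail : ∀ {c l} ys → l ≤ c → T (ascOKFrom c l ys) → Unique ys → All (ZeroOrAbove c) ys →
  ∃[ k ] ys ≡ canonicalTail c (length ys) k
classify-tail [] _ _ _ _ = zero , refl
classify-tail {c} {l} (0 ∷ ys) l≤c ok (0∉ys ∷ uniq) (_ ∷ ys-fresh)
  with classify-tail ys z≤n (subst T (ascOKFrom-0∷ c l ys) ok) uniq ys-fresh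
... | zero  , ys≡ = suc zero , cong (0 ∷_) ys≡
... | suc j , ys≡ = ⊥-elim (All.lookup 0∉ys (subst (0 ∈_) (sym ys≡) (0∈canonicalTail c _ j)) refl)
classify-tail {c} (y ∷ ys) l≤c ok (y∉ys ∷ uniq) (inj₂ c<y ∷ ys-fresh)
  with refl ← ≤-antisym (ascOKFrom-head y ys ok) c<y
  with classify-tail ys ≤-refl (subst T (ascOKFrom-suc∷ ys l≤c) ok) uniq
         (All.zipWith ZeroOrAbove-suc (ys-fresh , y∉ys))
... | zero  , ys≡ = zero , cong (y ∷_) ys≡
... | suc j , ys≡ = suc (suc j) , cong (y ∷_) ys≡

In𝒜 : ℕ → List ℕ → Set
In𝒜 n w = (length w ≡ n) × T (isAscentSeq w ∧ avoidsAll [000,011] w)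

In𝒜-irrelevant : ∀ n → Irrelevant (In𝒜 n)
In𝒜-irrelevant n (l , t) (l′ , t′) = cong₂ _,_ (≡-irrelevant l l′) (T-irrelevant t t′)

In𝒜⇒canonical : ∀ m w → In𝒜 (suc m) w → ∃[ k ] w ≡ canonical m k
In𝒜⇒canonical m (zero ∷ t) (refl , member) =
  let ok , av = to (T-∧ {ascOK (0 ∷ []) t}) member
      k , t≡  = classify-tail t z≤n (subst T (ascOK≡ascOKFrom [] 0 t) ok)
                  (to (avoids[000,011]⇔Unique t) av) (All.tabulate zeroOrPositive)
  in k , cong (0 ∷_) t≡
  where
  zeroOrPositive : ∀ {y} → y ∈ t → ZeroOrAbove 0 y
  zeroOrPositive {zero}  _ = inj₁ refl
  zeroOrPositive {suc y} _ = inj₂ (s≤s z≤n)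

canonical-In𝒜 : ∀ m k → In𝒜 (suc m) (canonical m k)
canonical-In𝒜 m k = cong suc (length-canonicalTail 0 m k) , from (T-∧ {ascOK (0 ∷ []) (canonicalTail 0 m k)})
  ( subst T (sym (ascOK≡ascOKFrom [] 0 (canonicalTail 0 m k))) (ascOKFrom-canonicalTail 0 0 m k z≤n)
  , from (avoids[000,011]⇔Unique _) (unique-canonicalTail 0 m k))

image⤖ : ∀ {a b p} {A : Set a} {B : Set b} {P : B → Set p} (f : A → B) → Injective _≡_ _≡_ f → Irrelevant P →
  (∀ x → P (f x)) → (∀ y → P y → ∃[ x ] y ≡ f x) → Σ B P ⤖ A
image⤖ {P = P} f f-inj P-irr P-image image-P =
  mk⤖ {to = index} (index-injective , strictlySurjective⇒surjective λ x → (f x , P-image x) , index-f x)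
  where
  index : Σ _ P → _
  index (y , py) = proj₁ (image-P y py)
  index-injective : Injective _≡_ _≡_ index
  index-injective {y , py} {y′ , py′} e with image-P y py | image-P y′ py′
  index-injective {y , py} {y′ , py′} refl | x , refl | x , refl = cong (f x ,_) (P-irr {f x} py py′)
  index-f : ∀ x → index (f x , P-image x) ≡ x
  index-f x = sym (f-inj (proj₂ (image-P (f x) (P-image x))))

proposition2p9 : (n : ℕ) → n ≥ 1 →
    𝒜 ((0 ∷ 0 ∷ 0 ∷ []) ∷ (0 ∷ 1 ∷ 1 ∷ []) ∷ []) n ⤖ Fin n
proposition2p9 (suc m) _ =
  image⤖ (canonical m) (λ e → canonicalTail-injective 0 m (∷-injectiveʳ e))
    (λ {w} → In𝒜-irrelevant (suc m) {w}) (canonical-In𝒜 m) (In𝒜⇒canonical m)
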